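{- Let $\chi$ be a character of $B_n$. If $\mathcal{B}$ and $\mathcal{B}'$ are finite sets endowed with maps $\mathrm{sDes}:\mathcal{B}\to\Sigma^B(n)$ and $\mathrm{sDes}:\mathcal{B}'\to\Sigma^B(n)$, both of which are fine sets for $\chi$, then $|\{b\in\mathcal{B}:\mathrm{sDes}(b)=\sigma\}|=|\{b\in\mathcal{B}':\mathrm{sDes}(b)=\sigma\}|$ for every $\sigma\in\Sigma^B(n)$; that is, the distribution of $\mathrm{sDes}$ over a fine set for $\chi$ is uniquely determined by $\chi$.
   Context: A signed set is a pair $\sigma=(S,\varepsilon)$ with $n\in S\subseteq[n]$ and $\varepsilon:S\to\{ -,+\}$; $\Sigma^B(n)$ is the set of these; its sign vector is $\tilde\varepsilon(j)=\varepsilon(\min\{s\in S:s\ge j\})$ for $j\in[n]$. A signed composition of $n$ is a composition $(\gamma_1,\dots,\gamma_k)$ of $n$ with some parts barred; let $r_i=\gamma_1+\dots+\gamma_i$, $r_0=0$, $S(\gamma)=\{r_1,\dots,r_k\}$, $I_i=\{r_{i-1}+1,\dots,r_i\}$. The weight $\mathrm{wt}_\gamma(\sigma)$ is $0$ if for some $i$ the set $S\cap\{r_{i-1}+1,\dots,r_i-1\}$ is not an initial segment of $\{r_{i-1}+1,\dots,r_i-1\}$ or $\tilde\varepsilon$ is not constant on $I_i$; otherwise it is $(-1)^{|S\setminus S(\gamma)|+n_\gamma(\sigma)}$, where $n_\gamma(\sigma)$ is the number of $i$ with $\tilde\varepsilon=-$ on $I_i$ and $\gamma_i$ barred. For a class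 function $\chi$ on $B_n$, $\chi(\gamma)$ is its value at elements of signed cycle type $(\alpha,\beta)$, $\alpha$ (resp. $\beta$) the decreasing rearrangement of the unbarred (resp. barred) parts of $\gamma$ (the signed cycle type of $w\in B_n$, viewed as a permutation of $\{1,\dots,n,\bar1,\dots,\bar n\}$, records lengths of positive cycles — pairs of disjoint cycles $c,\bar c$ — and of negative cycles $c=\bar c$, the latter counted with half their length). A set $\mathcal B$ with a map $\mathrm{sDes}:\mathcal B\to\Sigma^B(n)$ is a fine set for $\chi$ if $\chi(\gamma)=\sum_{b\in\mathcal B}\mathrm{wt}_\gamma(\mathrm{sDes}(b))$ for all signed compositions $\gamma$ of $n$. -}

module Defs where

open import Data.Bool using (Bool; true; false; if_then_else_; _∧_)
open import Data.Empty using (⊥)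
open import Data.Fin using (Fin)
open import Data.List using (List; []; _∷_; [_]; _++_; map; foldr; take; drop; length; filter)
open import Data.Nat.ListAction using (sum)
open import Data.List.Base using (allFin)
open import Data.Maybe using (Maybe; just; nothing; is-nothing)
open import Data.Nat using (ℕ; zero; suc; _≤_)
import Data.Nat.Properties as ℕP
open import Data.Integer using (ℤ; 0ℤ; 1ℤ; -1ℤ; _*_; _+_)
open import Data.Product using (Σ; _×_; _,_; proj₁; proj₂)
open import Data.Vec using (Vec; toList)
open import Relation.Binary.PropositionalEquality using (_≡_)
open import Relation.Nullary using (Dec; yes; no)
open import Relation.Nullary.Decidable using (⌊_⌋)
open import Relation.Binary.Definitions using (DecidableEquality)
open import Relation.Binary.Properties.DecTotalOrder ℕP.≤-decTotalOrder using (≥-decTotalOrder)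
import Data.List.Sort.InsertionSort as IS

all : {A : Set} → (A → Bool) → List A → Bool
all p []       = true
all p (x ∷ xs) = p x ∧ all p xs

data Sign : Set where
  plus minus : Sign

_≟Sign_ : DecidableEquality Sign
plus  ≟Sign plus  = yes Relation.Binary.PropositionalEquality.refl
minus ≟Sign minus = yes Relation.Binary.PropositionalEquality.refl
plus  ≟Sign minus = no (λ ())
minus ≟Sign plus  = no (λ ())

-- A signed set (S, ε) with n ∈ S ⊆ [n] is encoded, for n = suc m, by
-- a vector v of length m (entry j = just s  iff  j ∈ S and ε(j) = s,
-- entry j = nothing iff j ∉ S, for j = 1..m) together with the sign
-- ε(n) (n always belongs to S).

SignedSet : ℕ → Set
SignedSet zero    = ⊥
SignedSet (suc m) = Vec (Maybe Sign) m × Sign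

members : ∀ {n} → SignedSet n → List (Maybe Sign)
members {zero} ()
members {suc m} (v , e) = toList v ++ [ just e ]

-- ε(min {s ∈ S : s ≥ j}) for the first position j of the list
firstSign : List (Maybe Sign) → Sign → Sign
firstSign []               e = e
firstSign (nothing ∷ xs)   e = firstSign xs e
firstSign (just s  ∷ xs)   e = s

fill : List (Maybe Sign) → Sign → List Sign
fill []       e = e ∷ []
fill (x ∷ xs) e = firstSign (x ∷ xs) e ∷ fill xs e

signVector : ∀ {n} → SignedSet n → List Sign
signVector {zero} ()
signVector {suc m} (v , e) = fill (toList v) e

record Part : Set where
  constructor part
  field
    size   : ℕ
    barred : Bool
open Part public

SignedComposition : ℕ → Set
SignedComposition n =
  Σ (List Part) λ ps → (all (λ p → ⌊ 1 Data.Nat.≤? size p ⌋) ps ≡ true)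
                     × (sum (map size ps) ≡ n)

initialSeg : List (Maybe Sign) → Bool
initialSeg []             = true
initialSeg (just _ ∷ xs)  = initialSeg xs
initialSeg (nothing ∷ xs) = all is-nothing xs

countIn : List (Maybe Sign) → ℕ
countIn []             = 0
countIn (just _ ∷ xs)  = suc (countIn xs)
countIn (nothing ∷ xs) = countIn xs

negOnePow : ℕ → ℤ
negOnePow zero    = 1ℤ
negOnePow (suc k) = -1ℤ * negOnePow k

constantly : Sign → List Sign → Bool
constantly s = all (λ t → ⌊ t ≟Sign s ⌋)

-- contribution of one block I_i of size k (k ≥ 1):
-- ms = membership data on I_i, es = values of ε̃ on I_i
blockWt : Part → List (Maybe Sign) → List Sign → ℤ
blockWt p ms []       = 0ℤ   -- impossible for parts of size ≥ 1
blockWt p ms (s ∷ es) =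
  if initialSeg inner ∧ constantly s (s ∷ es)
  then negOnePow (countIn inner) * barSign s (barred p)
  else 0ℤ
  where
    -- positions r_{i-1}+1 .. r_i - 1
    inner = take (size p Data.Nat.∸ 1) ms
    barSign : Sign → Bool → ℤ
    barSign minus true = -1ℤ
    barSign _     _    = 1ℤ

wtBlocks : List Part → List (Maybe Sign) → List Sign → ℤ
wtBlocks []       ms es = 1ℤ
wtBlocks (p ∷ ps) ms es =
  blockWt p (take (size p) ms) (take (size p) es)
    * wtBlocks ps (drop (size p) ms) (drop (size p) es)

wt : ∀ {n} → SignedComposition n → SignedSet n → ℤ
wt (ps , _) σ = wtBlocks ps (members σ) (signVector σ)

-- Conjugacy classes of B_n are indexed by
-- signed cycle types (α, β): pairs of partitions (decreasing lists of
-- positive integers) with |α| + |β| = n.  A class function is a function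
-- of the signed cycle type.

ClassFunction : Set
ClassFunction = List ℕ → List ℕ → ℤ

sortDesc : List ℕ → List ℕ
sortDesc = IS.sort ≥-decTotalOrder

unbarredParts barredParts : List Part → List ℕ
unbarredParts ps = map size (filter (λ p → Relation.Nullary.Decidable.¬? (barred p Data.Bool.≟ true)) ps)
barredParts   ps = map size (filter (λ p → barred p Data.Bool.≟ true) ps)

valueAt : ∀ {n} → ClassFunction → SignedComposition n → ℤ
valueAt χ (ps , _) = χ (sortDesc (unbarredParts ps)) (sortDesc (barredParts ps))

-- Fine sets.  A finite set 𝓑 is represented as Fin N.

sumℤ : List ℤ → ℤ
sumℤ = foldr _+_ 0ℤ

IsFineSet : ∀ {n N} → ClassFunction → (Fin N → SignedSet n) → Set
IsFineSet {n} {N} χ sDes =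
  (γ : SignedComposition n) → valueAt χ γ ≡ sumℤ (map (λ b → wt γ (sDes b)) (allFin N))

_≟SS_ : ∀ {n} → DecidableEquality (SignedSet n)
_≟SS_ {zero} ()
_≟SS_ {suc m} = Data.Product.Properties.≡-dec
                  (Data.Vec.Properties.≡-dec (Data.Maybe.Properties.≡-dec _≟Sign_)) _≟Sign_
  where
    import Data.Product.Properties
    import Data.Vec.Properties
    import Data.Maybe.Properties

fiberSize : ∀ {n N} → (Fin N → SignedSet n) → SignedSet n → ℕ
fiberSize {n} {N} sDes σ = length (filter (λ b → sDes b ≟SS σ) (allFin N))

module Submission where

-- Fineness fixes the totals  Σ_b wt_γ(sDes b) = χ(γ)  for every signed
-- composition γ, hence, by linearity, the total  Σ_b φ(sDes b)  of every
-- function φ in the rational span of the weights wt_γ.  This span contains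
-- every integer function on Σ^B(n), in particular the indicator of σ, whose
-- total is the fibre size |{b : sDes b = σ}|.
--
-- Spanning is proved by induction on n, splitting a signed set of size n+2 on
-- its first position (absent from S, or present with sign + or −).  The
-- weights of (1, γ), (1̄, γ) and (γ₁ + 1, γ₂, …) are expressed through weights
-- of γ on positions 2..n+2 (block identities below); the last one involves a
-- weight whose first block is counted with an extra factor a+1 when its
-- interior avoids S.  So we work with these "boosted" weights at every level
-- a (level 0 being wt) and show that every function is spanned at every level
-- (allSpanned).

open import Defs
open import Data.Nat using (ℕ)
open import Data.Fin using (Fin)
open import Relation.Binary.PropositionalEquality using (_≡_)

open import Data.Bool using (Bool; true; false; if_then_else_; _∧_)
open import Data.List using (List; []; _∷_; map; take; drop; length; filter)
open import Data.List.Base using (allFin)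
open import Data.List.Properties using (map-cong)
open import Data.Maybe using (Maybe; just; nothing; is-nothing)
open import Data.Nat using (zero; suc; _∸_) renaming (_+_ to _+ℕ_; _*_ to _*ℕ_)
open import Data.Integer using (ℤ; +_; 0ℤ; 1ℤ; -1ℤ; _*_; _+_; _-_; -_)
import Data.Integer.Properties as ℤP
open import Algebra.Properties.CommutativeSemigroup ℤP.*-commutativeSemigroup
  using () renaming (x∙yz≈y∙xz to *-swap)
open import Data.Integer.Tactic.RingSolver using (solve-∀)
open import Data.Product using (_,_; proj₂)
open import Data.Vec using (toList) renaming ([] to []ᵥ; _∷_ to _∷ᵥ_)
open import Relation.Binary.PropositionalEquality
  using (refl; sym; trans; cong; cong₂; module ≡-Reasoning)
open import Relation.Nullary using (yes; no)

open ≡-Reasoning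

barSign : Sign → Bool → ℤ
barSign minus true = -1ℤ
barSign _     _    = 1ℤ

signValue : Sign → ℤ
signValue plus  = 1ℤ
signValue minus = -1ℤ

signEq : Sign → Sign → ℤ
signEq plus  plus  = 1ℤ
signEq minus minus = 1ℤ
signEq plus  minus = 0ℤ
signEq minus plus  = 0ℤ

signEq-refl : ∀ s → signEq s s ≡ 1ℤ
signEq-refl plus  = refl
signEq-refl minus = refl

signEq-split : ∀ s t → signEq s t ≡ signEq s plus * signEq t plus + signEq s minus * signEq t minus
signEq-split plus  plus  = refl
signEq-split plus  minus = refl
signEq-split minus plus  = refl
signEq-split minus minus = refl

-- An unbarred and a barred unit block, combined with coefficients 1 and s,
-- detect the sign f of the block:  barSign f false + s·barSign f true = 2·[f = s].
barSign-filter : ∀ f s → barSign f false + signValue s * barSign f true ≡ + 2 * signEq f s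
barSign-filter plus  plus  = refl
barSign-filter plus  minus = refl
barSign-filter minus plus  = refl
barSign-filter minus minus = refl

-- Coefficient of a block whose interior meets S in t positions, boosted
-- from 1 to a+1 when the interior avoids S.
boostedCoef : ℕ → ℕ → ℤ
boostedCoef a zero    = + suc a
boostedCoef a (suc t) = negOnePow (suc t)

boostedCoef-zero : ∀ t → boostedCoef 0 t ≡ negOnePow t
boostedCoef-zero zero    = refl
boostedCoef-zero (suc t) = refl

-- Interior factor of a block: I = membership data of the interior, C = is
-- the sign vector constant on the block.
interiorWt : ℕ → List (Maybe Sign) → Bool → ℤ
interiorWt a I C = if initialSeg I ∧ C then boostedCoef a (countIn I) else 0ℤ

boostedBlockWt : ℕ → Part → List (Maybe Sign) → List Sign → ℤ
boostedBlockWt a p ms []       = 0ℤ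
boostedBlockWt a p ms (s ∷ es) =
  interiorWt a (take (size p ∸ 1) ms) (constantly s (s ∷ es)) * barSign s (barred p)

boostedWtBlocks : ℕ → List Part → List (Maybe Sign) → List Sign → ℤ
boostedWtBlocks a []       ms es = 1ℤ
boostedWtBlocks a (p ∷ ps) ms es =
  boostedBlockWt a p (take (size p) ms) (take (size p) es)
    * wtBlocks ps (drop (size p) ms) (drop (size p) es)

boostedWt : ∀ {n} → ℕ → SignedComposition n → SignedSet n → ℤ
boostedWt a (ps , _) σ = boostedWtBlocks a ps (members σ) (signVector σ)

boostedWt-zero : ∀ {n} (γ : SignedComposition n) σ → boostedWt 0 γ σ ≡ wt γ σ
boostedWt-zero ([] , _) σ = refl
boostedWt-zero (p ∷ ps , _) σ =
  cong (_* wtBlocks ps (drop (size p) (members σ)) (drop (size p) (signVector σ)))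
       (block p (take (size p) (members σ)) (take (size p) (signVector σ)))
  where
  block : ∀ p ms es → boostedBlockWt 0 p ms es ≡ blockWt p ms es
  block p ms [] = refl
  block p ms (s ∷ es) with initialSeg (take (size p ∸ 1) ms) ∧ constantly s (s ∷ es)
  ... | false = ℤP.*-zeroˡ (barSign s (barred p))
  ... | true with countIn (take (size p ∸ 1) ms) | s | barred p
  ...   | zero  | plus  | _     = refl
  ...   | zero  | minus | true  = refl
  ...   | zero  | minus | false = refl
  ...   | suc t | plus  | _     = refl
  ...   | suc t | minus | true  = refl
  ...   | suc t | minus | false = refl

*-distribʳ-minus : ∀ x y z → (x - y) * z ≡ x * z - y * z
*-distribʳ-minus = solve-∀

-- Blocks seen from their first position.  If that position is absent from
-- S, the interior factor is a difference of two boost levels of the shorter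
-- interior; if it is present, the interior contains one more element of S,
-- which flips the sign.

allNothing⇒countIn≡0 : ∀ I → all is-nothing I ≡ true → countIn I ≡ 0
allNothing⇒countIn≡0 []            _  = refl
allNothing⇒countIn≡0 (nothing ∷ I) eq = allNothing⇒countIn≡0 I eq

-- an interior starting outside S meets S in an initial segment only if it avoids S
interiorWt-absent : ∀ a I C →
  interiorWt a (nothing ∷ I) C ≡ interiorWt (suc a) I C - interiorWt 0 I C
interiorWt-absent a [] true  = refl
interiorWt-absent a [] false = refl
interiorWt-absent a (nothing ∷ I) C with all is-nothing I in eq
... | true rewrite allNothing⇒countIn≡0 I eq = interiorWt-absent a [] C
... | false = refl
interiorWt-absent a (just s ∷ I) C = sym (ℤP.+-inverseʳ (interiorWt 0 (just s ∷ I) C))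

interiorWt-present : ∀ a s I C → interiorWt a (just s ∷ I) C ≡ - interiorWt 0 I C
interiorWt-present a s I C with initialSeg I ∧ C
... | true  = trans (ℤP.-1*i≡-i (negOnePow (countIn I)))
                    (cong -_ (sym (boostedCoef-zero (countIn I))))
... | false = refl

interiorWt-inconsistent : ∀ a I → interiorWt a I false ≡ 0ℤ
interiorWt-inconsistent a I with initialSeg I
... | true  = refl
... | false = refl

-- a block of size 1 has empty interior
blockWt-unit : ∀ a b x f → boostedBlockWt a (part 1 b) (x ∷ []) (f ∷ []) ≡ + suc a * barSign f b
blockWt-unit a b x plus  = refl
blockWt-unit a b x minus = refl

-- first position ∉ S: ε̃ takes the same value g on positions 1 and 2
blockWt-absent : ∀ a k b T g E →
  boostedBlockWt a (part (suc (suc k)) b) (nothing ∷ T) (g ∷ g ∷ E) ≡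
  boostedBlockWt (suc a) (part (suc k) b) T (g ∷ E) - boostedBlockWt 0 (part (suc k) b) T (g ∷ E)
blockWt-absent a k b T g E = begin
  interiorWt a (nothing ∷ take k T) (constantly g (g ∷ g ∷ E)) * barSign g b
    ≡⟨ cong (λ C → interiorWt a (nothing ∷ take k T) C * barSign g b) (constantly-repeat g E) ⟩
  interiorWt a (nothing ∷ take k T) C * barSign g b
    ≡⟨ cong (_* barSign g b) (interiorWt-absent a (take k T) C) ⟩
  (interiorWt (suc a) (take k T) C - interiorWt 0 (take k T) C) * barSign g b
    ≡⟨ *-distribʳ-minus (interiorWt (suc a) (take k T) C) (interiorWt 0 (take k T) C) (barSign g b) ⟩
  interiorWt (suc a) (take k T) C * barSign g b - interiorWt 0 (take k T) C * barSign g b ∎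
  where
  C = constantly g (g ∷ E)
  constantly-repeat : ∀ g E → constantly g (g ∷ g ∷ E) ≡ constantly g (g ∷ E)
  constantly-repeat plus  E = refl
  constantly-repeat minus E = refl

interiorWt-continue : ∀ a s I C z →
  interiorWt a (just s ∷ I) C * z ≡ - (1ℤ * (interiorWt 0 I C * z))
interiorWt-continue a s I C z = begin
  interiorWt a (just s ∷ I) C * z ≡⟨ cong (_* z) (interiorWt-present a s I C) ⟩
  - interiorWt 0 I C * z          ≡⟨ reassoc (interiorWt 0 I C) z ⟩
  - (1ℤ * (interiorWt 0 I C * z)) ∎
  where
  reassoc : ∀ x z → - x * z ≡ - (1ℤ * (x * z))
  reassoc = solve-∀

-- first position ∈ S with a sign different from ε̃(2): ε̃ is not constant
-- (the right-hand side is the shape of the statement below for signEq s g = 0)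
interiorWt-break : ∀ a s I z y → interiorWt a (just s ∷ I) false * z ≡ - (0ℤ * y)
interiorWt-break a s I z y = begin
  interiorWt a (just s ∷ I) false * z ≡⟨ cong (_* z) (interiorWt-inconsistent a (just s ∷ I)) ⟩
  0ℤ * z                              ≡⟨ vanish z y ⟩
  - (0ℤ * y)                          ∎
  where
  vanish : ∀ z y → 0ℤ * z ≡ - (0ℤ * y)
  vanish = solve-∀

blockWt-present : ∀ a k b T s g E →
  boostedBlockWt a (part (suc (suc k)) b) (just s ∷ T) (s ∷ g ∷ E) ≡
  - (signEq s g * boostedBlockWt 0 (part (suc k) b) T (g ∷ E))
blockWt-present a k b T plus  plus  E =
  interiorWt-continue a plus (take k T) (constantly plus E) (barSign plus b)
blockWt-present a k b T minus minus E =
  interiorWt-continue a minus (take k T) (constantly minus E) (barSign minus b)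
blockWt-present a k b T plus  minus E =
  interiorWt-break a plus (take k T) (barSign plus b) (boostedBlockWt 0 (part (suc k) b) T (minus ∷ E))
blockWt-present a k b T minus plus  E =
  interiorWt-break a minus (take k T) (barSign minus b) (boostedBlockWt 0 (part (suc k) b) T (plus ∷ E))

firstEntry : ∀ {m} → SignedSet (suc (suc m)) → Maybe Sign
firstEntry (x ∷ᵥ _ , _) = x

dropFirst : ∀ {m} → SignedSet (suc (suc m)) → SignedSet (suc m)
dropFirst (_ ∷ᵥ v , e) = (v , e)

withFirst : ∀ {m} → Maybe Sign → SignedSet (suc m) → SignedSet (suc (suc m))
withFirst x (v , e) = (x ∷ᵥ v , e)

leadingSign : ∀ {m} → SignedSet (suc m) → Sign
leadingSign (v , e) = firstSign (toList v) e

prependUnit : ∀ {m} → Bool → SignedComposition (suc m) → SignedComposition (suc (suc m))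
prependUnit b (ps , positive , total) = (part 1 b ∷ ps , positive , cong suc total)

extendFirst : ∀ {m} → SignedComposition (suc m) → SignedComposition (suc (suc m))
extendFirst ([] , _ , ())
extendFirst (part zero b ∷ ps , () , _)
extendFirst (part (suc k) b ∷ ps , positive , total) =
  (part (suc (suc k)) b ∷ ps , positive , cong suc total)

boostedWt-prependUnit : ∀ a b {m} (γ : SignedComposition (suc m)) τ →
  boostedWt a (prependUnit b γ) τ ≡ + suc a * barSign (leadingSign τ) b * wt γ (dropFirst τ)
boostedWt-prependUnit a b (ps , _) (x ∷ᵥ v , e) =
  cong (_* wtBlocks ps (members (v , e)) (fill (toList v) e))
       (blockWt-unit a b x (firstSign (x ∷ toList v) e))

wtBlocks-absent : ∀ a k b ps ms g E →
  boostedWtBlocks a (part (suc (suc k)) b ∷ ps) (nothing ∷ ms) (g ∷ g ∷ E) ≡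
  boostedWtBlocks (suc a) (part (suc k) b ∷ ps) ms (g ∷ E)
    - boostedWtBlocks 0 (part (suc k) b ∷ ps) ms (g ∷ E)
wtBlocks-absent a k b ps ms g E =
  trans (cong (_* rest) (blockWt-absent a k b (take (suc k) ms) g (take k E)))
        (*-distribʳ-minus (boostedBlockWt (suc a) (part (suc k) b) (take (suc k) ms) (g ∷ take k E))
                 (boostedBlockWt 0 (part (suc k) b) (take (suc k) ms) (g ∷ take k E)) rest)
  where
  rest = wtBlocks ps (drop (suc k) ms) (drop k E)

wtBlocks-present : ∀ a k b ps ms s g E →
  boostedWtBlocks a (part (suc (suc k)) b ∷ ps) (just s ∷ ms) (s ∷ g ∷ E) ≡
  - (signEq s g * boostedWtBlocks 0 (part (suc k) b ∷ ps) ms (g ∷ E))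
wtBlocks-present a k b ps ms s g E =
  trans (cong (_* rest) (blockWt-present a k b (take (suc k) ms) s g (take k E)))
        (reassoc (signEq s g) (boostedBlockWt 0 (part (suc k) b) (take (suc k) ms) (g ∷ take k E)) rest)
  where
  rest = wtBlocks ps (drop (suc k) ms) (drop k E)
  reassoc : ∀ q x z → - (q * x) * z ≡ - (q * (x * z))
  reassoc = solve-∀

-- Position 1 ∉ S: enlarging the first part turns boost level a+1 into a
-- difference of boost levels.  (The sign vector of σ starts with ε̃(1),
-- which then also starts that of withFirst nothing σ; hence the split on v.)
boostedWt-extendFirst-absent : ∀ a {m} (γ : SignedComposition (suc m)) σ →
  boostedWt a (extendFirst γ) (withFirst nothing σ) ≡ boostedWt (suc a) γ σ - boostedWt 0 γ σ
boostedWt-extendFirst-absent a ([] , _ , ()) σ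
boostedWt-extendFirst-absent a (part zero b ∷ ps , () , _) σ
boostedWt-extendFirst-absent a (part (suc k) b ∷ ps , _ , _) ([]ᵥ , e) =
  wtBlocks-absent a k b ps (just e ∷ []) e []
boostedWt-extendFirst-absent a (part (suc k) b ∷ ps , _ , _) (y ∷ᵥ v , e) =
  wtBlocks-absent a k b ps (members (y ∷ᵥ v , e)) (firstSign (y ∷ toList v) e) (fill (toList v) e)

-- Position 1 ∈ S with sign s: the first block now contains one more element
-- of S in its interior, and it needs ε̃(2) = s.
boostedWt-extendFirst-present : ∀ a {m} (γ : SignedComposition (suc m)) s σ →
  boostedWt a (extendFirst γ) (withFirst (just s) σ) ≡ - (signEq s (leadingSign σ) * boostedWt 0 γ σ)
boostedWt-extendFirst-present a ([] , _ , ()) s σ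
boostedWt-extendFirst-present a (part zero b ∷ ps , () , _) s σ
boostedWt-extendFirst-present a (part (suc k) b ∷ ps , _ , _) s ([]ᵥ , e) =
  wtBlocks-present a k b ps (just e ∷ []) s e []
boostedWt-extendFirst-present a (part (suc k) b ∷ ps , _ , _) s (y ∷ᵥ v , e) =
  wtBlocks-present a k b ps (members (y ∷ᵥ v , e)) s (firstSign (y ∷ toList v) e) (fill (toList v) e)

data Combination (n : ℕ) : Set where
  weight : SignedComposition n → Combination n
  scale  : ℤ → Combination n → Combination n
  _⊕_    : Combination n → Combination n → Combination n

evaluate : ∀ {n} → ℕ → Combination n → SignedSet n → ℤ
evaluate a (weight γ)  τ = boostedWt a γ τ
evaluate a (scale c f) τ = c * evaluate a f τ
evaluate a (f ⊕ g)     τ = evaluate a f τ + evaluate a g τ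

-- φ is spanned at level a if a positive multiple of φ is a combination of
-- level-a weights, i.e. φ lies in their rational span.
record Spanned (n a : ℕ) (φ : SignedSet n → ℤ) : Set where
  constructor spanning
  field
    multiplier  : ℕ
    combination : Combination n
    represents  : ∀ τ → + suc multiplier * φ τ ≡ evaluate a combination τ

module _ {n a : ℕ} where

  spanned-cong : ∀ {φ ψ} → (∀ τ → φ τ ≡ ψ τ) → Spanned n a ψ → Spanned n a φ
  spanned-cong φ≗ψ (spanning k f e) = spanning k f λ τ → trans (cong (+ suc k *_) (φ≗ψ τ)) (e τ)

  spanned-weight : ∀ γ → Spanned n a (boostedWt a γ)
  spanned-weight γ = spanning 0 (weight γ) λ τ → ℤP.*-identityˡ (boostedWt a γ τ)

  spanned-scale : ∀ c {φ} → Spanned n a φ → Spanned n a (λ τ → c * φ τ)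
  spanned-scale c {φ} (spanning k f e) = spanning k (scale c f) λ τ →
    trans (*-swap (+ suc k) c (φ τ)) (cong (c *_) (e τ))

  spanned-+ : ∀ {φ ψ} → Spanned n a φ → Spanned n a ψ → Spanned n a (λ τ → φ τ + ψ τ)
  spanned-+ {φ} {ψ} (spanning k f e) (spanning l g d) =
    spanning (l +ℕ k *ℕ suc l) (scale (+ suc l) f ⊕ scale (+ suc k) g) λ τ →
    trans (expand (+ suc k) (+ suc l) (φ τ) (ψ τ))
          (cong₂ (λ u v → + suc l * u + + suc k * v) (e τ) (d τ))
    where
    expand : ∀ K L x y → K * L * (x + y) ≡ L * (K * x) + K * (L * y)
    expand = solve-∀

  spanned-- : ∀ {φ ψ} → Spanned n a φ → Spanned n a ψ → Spanned n a (λ τ → φ τ - ψ τ)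
  spanned-- {ψ = ψ} sφ sψ =
    spanned-+ sφ (spanned-cong (λ τ → sym (ℤP.-1*i≡-i (ψ τ))) (spanned-scale -1ℤ sψ))

  spanned-divide : ∀ l {φ} → Spanned n a (λ τ → + suc l * φ τ) → Spanned n a φ
  spanned-divide l {φ} (spanning k f e) =
    spanning (l +ℕ k *ℕ suc l) f λ τ → trans (ℤP.*-assoc (+ suc k) (+ suc l) (φ τ)) (e τ)

-- Products L(τ)·ψ(tail τ) are spanned for every spanned ψ as soon as they
-- are spanned for the weights ψ = boostedWt b γ: the product is linear in ψ.
spanned-lift : ∀ {m a b} (L : SignedSet (suc (suc m)) → ℤ) →
  (∀ γ → Spanned (suc (suc m)) a (λ τ → L τ * boostedWt b γ (dropFirst τ))) →
  ∀ {ψ} → Spanned (suc m) b ψ → Spanned (suc (suc m)) a (λ τ → L τ * ψ (dropFirst τ))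
spanned-lift {m} {a} {b} L spanned-weights {ψ} (spanning k f e) =
  spanned-divide k (spanned-cong multiple (lift f))
  where
  lift : ∀ f → Spanned (suc (suc m)) a (λ τ → L τ * evaluate b f (dropFirst τ))
  lift (weight γ)  = spanned-weights γ
  lift (scale c f) =
    spanned-cong (λ τ → *-swap (L τ) c (evaluate b f (dropFirst τ))) (spanned-scale c (lift f))
  lift (f ⊕ g)     = spanned-cong (λ τ → ℤP.*-distribˡ-+ (L τ) _ _) (spanned-+ (lift f) (lift g))
  multiple : ∀ τ → + suc k * (L τ * ψ (dropFirst τ)) ≡ L τ * evaluate b f (dropFirst τ)
  multiple τ = trans (*-swap (+ suc k) (L τ) (ψ (dropFirst τ))) (cong (L τ *_) (e (dropFirst τ)))

unitPair : ∀ A W f s →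
  A * barSign f false * W + signValue s * (A * barSign f true * W) ≡ (A + A) * (signEq f s * W)
unitPair A W f s = begin
  A * barSign f false * W + signValue s * (A * barSign f true * W)
    ≡⟨ factor A W (barSign f false) (signValue s) (barSign f true) ⟩
  A * (barSign f false + signValue s * barSign f true) * W
    ≡⟨ cong (λ u → A * u * W) (barSign-filter f s) ⟩
  A * (+ 2 * signEq f s) * W
    ≡⟨ collect A W (signEq f s) ⟩
  (A + A) * (signEq f s * W) ∎
  where
  factor : ∀ A W p q r → A * p * W + q * (A * r * W) ≡ A * (p + q * r) * W
  factor = solve-∀
  collect : ∀ A W t → A * (+ 2 * t) * W ≡ (A + A) * (t * W)
  collect = solve-∀

unitComposition : Bool → SignedComposition 1
unitComposition b = (part 1 b ∷ [] , refl , refl)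

-- (a+1)·(wt_(1) + s·wt_(1̄)) = 2(a+1)·[ε(1) = s] on Σ^B(1)
spanned-sign₁ : ∀ a s → Spanned 1 a (λ τ → signEq (proj₂ τ) s)
spanned-sign₁ a s =
  spanned-divide (a +ℕ suc a)
    (spanned-cong pair
      (spanned-+ (spanned-weight (unitComposition false))
                 (spanned-scale (signValue s) (spanned-weight (unitComposition true)))))
  where
  A = + suc a
  pair : ∀ τ → + suc (a +ℕ suc a) * signEq (proj₂ τ) s ≡
               boostedWt a (unitComposition false) τ + signValue s * boostedWt a (unitComposition true) τ
  pair ([]ᵥ , e) = begin
    + suc (a +ℕ suc a) * signEq e s
      ≡⟨ cong₂ _*_ (ℤP.pos-+ (suc a) (suc a)) (sym (ℤP.*-identityʳ (signEq e s))) ⟩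
    (A + A) * (signEq e s * 1ℤ)
      ≡⟨ sym (unitPair A 1ℤ e s) ⟩
    A * barSign e false * 1ℤ + signValue s * (A * barSign e true * 1ℤ)
      ≡⟨ sym (cong₂ (λ u v → u * 1ℤ + signValue s * (v * 1ℤ))
                    (blockWt-unit a false (just e) e) (blockWt-unit a true (just e) e)) ⟩
    boostedWt a (unitComposition false) ([]ᵥ , e)
      + signValue s * boostedWt a (unitComposition true) ([]ᵥ , e) ∎

spanned-leadingSign : ∀ {m} a s {ψ} → Spanned (suc m) 0 ψ →
  Spanned (suc (suc m)) a (λ τ → signEq (leadingSign τ) s * ψ (dropFirst τ))
spanned-leadingSign a s = spanned-lift (λ τ → signEq (leadingSign τ) s) λ γ →
  spanned-divide (a +ℕ suc a)
    (spanned-cong (pair γ)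
      (spanned-+ (spanned-weight (prependUnit false γ))
                 (spanned-scale (signValue s) (spanned-weight (prependUnit true γ)))))
  where
  A = + suc a
  pair : ∀ γ τ → + suc (a +ℕ suc a) * (signEq (leadingSign τ) s * boostedWt 0 γ (dropFirst τ)) ≡
                 boostedWt a (prependUnit false γ) τ + signValue s * boostedWt a (prependUnit true γ) τ
  pair γ τ = begin
    + suc (a +ℕ suc a) * (signEq f s * boostedWt 0 γ (dropFirst τ))
      ≡⟨ cong₂ (λ K w → K * (signEq f s * w))
               (ℤP.pos-+ (suc a) (suc a)) (boostedWt-zero γ (dropFirst τ)) ⟩
    (A + A) * (signEq f s * wt γ (dropFirst τ))
      ≡⟨ sym (unitPair A (wt γ (dropFirst τ)) f s) ⟩
    A * barSign f false * wt γ (dropFirst τ) + signValue s * (A * barSign f true * wt γ (dropFirst τ))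
      ≡⟨ sym (cong₂ (λ u v → u + signValue s * v)
                    (boostedWt-prependUnit a false γ τ) (boostedWt-prependUnit a true γ τ)) ⟩
    boostedWt a (prependUnit false γ) τ + signValue s * boostedWt a (prependUnit true γ) τ ∎
    where
    f = leadingSign τ

-- [ε̃(1) = ε̃(2)]·ψ(tail τ), splitting the agreement over the common sign.
spanned-agreement : ∀ {m} a → (∀ φ → Spanned (suc m) 0 φ) → (ψ : SignedSet (suc m) → ℤ) →
  Spanned (suc (suc m)) a (λ τ → signEq (leadingSign τ) (leadingSign (dropFirst τ)) * ψ (dropFirst τ))
spanned-agreement a spanned₀ ψ =
  spanned-cong split
    (spanned-+ (spanned-leadingSign a plus  (spanned₀ (λ σ → signEq (leadingSign σ) plus  * ψ σ)))
               (spanned-leadingSign a minus (spanned₀ (λ σ → signEq (leadingSign σ) minus * ψ σ))))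
  where
  distribute : ∀ p q r t x → (p * q + r * t) * x ≡ p * (q * x) + r * (t * x)
  distribute = solve-∀
  split : ∀ τ → signEq (leadingSign τ) (leadingSign (dropFirst τ)) * ψ (dropFirst τ) ≡
    signEq (leadingSign τ) plus  * (signEq (leadingSign (dropFirst τ)) plus  * ψ (dropFirst τ)) +
    signEq (leadingSign τ) minus * (signEq (leadingSign (dropFirst τ)) minus * ψ (dropFirst τ))
  split τ = trans (cong (_* ψ (dropFirst τ)) (signEq-split (leadingSign τ) (leadingSign (dropFirst τ))))
                  (distribute (signEq (leadingSign τ) plus) (signEq (leadingSign (dropFirst τ)) plus)
                              (signEq (leadingSign τ) minus) (signEq (leadingSign (dropFirst τ)) minus)
                              (ψ (dropFirst τ)))

isAbsent : Maybe Sign → ℤ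
isAbsent nothing  = 1ℤ
isAbsent (just _) = 0ℤ

isPresent : Sign → Maybe Sign → ℤ
isPresent s nothing  = 0ℤ
isPresent s (just t) = signEq t s

-- [1 ∉ S]·ψ(tail τ), for ψ spanned at the next boost level: enlarging the
-- first part of γ yields [1 ∉ S]·boostedWt (a+1) γ up to an agreement term.
spanned-absent : ∀ {m} a → (∀ φ → Spanned (suc m) 0 φ) → ∀ {ψ} → Spanned (suc m) (suc a) ψ →
  Spanned (suc (suc m)) a (λ τ → isAbsent (firstEntry τ) * ψ (dropFirst τ))
spanned-absent a spanned₀ = spanned-lift (λ τ → isAbsent (firstEntry τ)) λ γ →
  spanned-cong (pointwise γ)
    (spanned-+ (spanned-weight (extendFirst γ)) (spanned-agreement a spanned₀ (wt γ)))
  where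
  pointwise : ∀ γ τ → isAbsent (firstEntry τ) * boostedWt (suc a) γ (dropFirst τ) ≡
    boostedWt a (extendFirst γ) τ + signEq (leadingSign τ) (leadingSign (dropFirst τ)) * wt γ (dropFirst τ)
  pointwise γ (nothing ∷ᵥ v , e) = sym (begin
    boostedWt a (extendFirst γ) (withFirst nothing σ) + signEq g g * wt γ σ
      ≡⟨ cong₂ _+_ (boostedWt-extendFirst-absent a γ σ) (cong (_* wt γ σ) (signEq-refl g)) ⟩
    boostedWt (suc a) γ σ - boostedWt 0 γ σ + 1ℤ * wt γ σ
      ≡⟨ cong (λ w → boostedWt (suc a) γ σ - w + 1ℤ * wt γ σ) (boostedWt-zero γ σ) ⟩
    boostedWt (suc a) γ σ - wt γ σ + 1ℤ * wt γ σ
      ≡⟨ cancel (boostedWt (suc a) γ σ) (wt γ σ) ⟩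
    1ℤ * boostedWt (suc a) γ σ ∎)
    where
    σ = (v , e)
    g = leadingSign σ
    cancel : ∀ x y → x - y + 1ℤ * y ≡ 1ℤ * x
    cancel = solve-∀
  pointwise γ (just s ∷ᵥ v , e) = sym (begin
    boostedWt a (extendFirst γ) (withFirst (just s) σ) + q * wt γ σ
      ≡⟨ cong (_+ q * wt γ σ) (boostedWt-extendFirst-present a γ s σ) ⟩
    - (q * boostedWt 0 γ σ) + q * wt γ σ
      ≡⟨ cong (λ w → - (q * w) + q * wt γ σ) (boostedWt-zero γ σ) ⟩
    - (q * wt γ σ) + q * wt γ σ
      ≡⟨ ℤP.+-inverseˡ (q * wt γ σ) ⟩
    0ℤ ∎)
    where
    σ = (v , e)
    q = signEq s (leadingSign σ)

-- [1 ∈ S, ε(1) = s]·ψ(tail τ) = [ε̃(1) = s]·ψ(tail τ) − [1 ∉ S]·[ε̃(2) = s]·ψ(tail τ)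
spanned-present : ∀ {m} a s → (∀ φ → Spanned (suc m) 0 φ) → (∀ φ → Spanned (suc m) (suc a) φ) →
  (ψ : SignedSet (suc m) → ℤ) →
  Spanned (suc (suc m)) a (λ τ → isPresent s (firstEntry τ) * ψ (dropFirst τ))
spanned-present a s spanned₀ spanned₁ ψ =
  spanned-cong pointwise
    (spanned-- (spanned-leadingSign a s (spanned₀ ψ))
               (spanned-absent a spanned₀ (spanned₁ (λ σ → signEq (leadingSign σ) s * ψ σ))))
  where
  absent : ∀ q y → 0ℤ * y ≡ q * y - 1ℤ * (q * y)
  absent = solve-∀
  present : ∀ q y z → q * y ≡ q * y - 0ℤ * z
  present = solve-∀
  pointwise : ∀ τ → isPresent s (firstEntry τ) * ψ (dropFirst τ) ≡
    signEq (leadingSign τ) s * ψ (dropFirst τ)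
      - isAbsent (firstEntry τ) * (signEq (leadingSign (dropFirst τ)) s * ψ (dropFirst τ))
  pointwise (nothing ∷ᵥ v , e) = absent (signEq (leadingSign (v , e)) s) (ψ (v , e))
  pointwise (just t  ∷ᵥ v , e) =
    present (signEq t s) (ψ (v , e)) (signEq (leadingSign (v , e)) s * ψ (v , e))

spanned-size₁ : ∀ a φ → Spanned 1 a φ
spanned-size₁ a φ =
  spanned-cong pointwise
    (spanned-+ (spanned-scale (φ ([]ᵥ , plus))  (spanned-sign₁ a plus))
               (spanned-scale (φ ([]ᵥ , minus)) (spanned-sign₁ a minus)))
  where
  pickPlus : ∀ x y → x ≡ x * 1ℤ + y * 0ℤ
  pickPlus = solve-∀
  pickMinus : ∀ x y → y ≡ x * 0ℤ + y * 1ℤ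
  pickMinus = solve-∀
  pointwise : ∀ τ →
    φ τ ≡ φ ([]ᵥ , plus) * signEq (proj₂ τ) plus + φ ([]ᵥ , minus) * signEq (proj₂ τ) minus
  pointwise ([]ᵥ , plus)  = pickPlus  (φ ([]ᵥ , plus)) (φ ([]ᵥ , minus))
  pointwise ([]ᵥ , minus) = pickMinus (φ ([]ᵥ , plus)) (φ ([]ᵥ , minus))

-- φ on Σ^B(n+2) splits according to the entry of position 1; the induction
-- on n uses level 0 and level a+1 for size n+1 to reach level a for size n+2.
allSpanned : ∀ m a φ → Spanned (suc m) a φ
allSpanned zero    a φ = spanned-size₁ a φ
allSpanned (suc m) a φ =
  spanned-cong pointwise
    (spanned-+ (spanned-absent a (allSpanned m 0) (allSpanned m (suc a) (restrict nothing)))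
      (spanned-+ (spanned-present a plus  (allSpanned m 0) (allSpanned m (suc a)) (restrict (just plus)))
                 (spanned-present a minus (allSpanned m 0) (allSpanned m (suc a)) (restrict (just minus)))))
  where
  restrict : Maybe Sign → SignedSet (suc m) → ℤ
  restrict x σ = φ (withFirst x σ)
  pickFirst : ∀ x y z → x ≡ 1ℤ * x + (0ℤ * y + 0ℤ * z)
  pickFirst = solve-∀
  pickSecond : ∀ x y z → x ≡ 0ℤ * y + (1ℤ * x + 0ℤ * z)
  pickSecond = solve-∀
  pickThird : ∀ x y z → x ≡ 0ℤ * y + (0ℤ * z + 1ℤ * x)
  pickThird = solve-∀
  pointwise : ∀ τ → φ τ ≡
    isAbsent (firstEntry τ) * restrict nothing (dropFirst τ) +
    (isPresent plus (firstEntry τ) * restrict (just plus) (dropFirst τ) +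
     isPresent minus (firstEntry τ) * restrict (just minus) (dropFirst τ))
  pointwise (nothing ∷ᵥ v , e) =
    pickFirst (φ (nothing ∷ᵥ v , e)) (φ (just plus ∷ᵥ v , e)) (φ (just minus ∷ᵥ v , e))
  pointwise (just plus ∷ᵥ v , e) =
    pickSecond (φ (just plus ∷ᵥ v , e)) (φ (nothing ∷ᵥ v , e)) (φ (just minus ∷ᵥ v , e))
  pointwise (just minus ∷ᵥ v , e) =
    pickThird (φ (just minus ∷ᵥ v , e)) (φ (nothing ∷ᵥ v , e)) (φ (just plus ∷ᵥ v , e))

sumℤ-scale : ∀ {A : Set} c (f : A → ℤ) L → sumℤ (map (λ x → c * f x) L) ≡ c * sumℤ (map f L)
sumℤ-scale c f []      = sym (ℤP.*-zeroʳ c)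
sumℤ-scale c f (x ∷ L) =
  trans (cong (λ r → c * f x + r) (sumℤ-scale c f L)) (sym (ℤP.*-distribˡ-+ c (f x) _))

sumℤ-add : ∀ {A : Set} (f g : A → ℤ) L →
  sumℤ (map (λ x → f x + g x) L) ≡ sumℤ (map f L) + sumℤ (map g L)
sumℤ-add f g []      = refl
sumℤ-add f g (x ∷ L) =
  trans (cong (λ r → f x + g x + r) (sumℤ-add f g L))
        (interchange (f x) (g x) (sumℤ (map f L)) (sumℤ (map g L)))
  where
  interchange : ∀ x y X Y → x + y + (X + Y) ≡ x + X + (y + Y)
  interchange = solve-∀

-- Σ_{b ∈ 𝓑} φ(sDes b); fineness says  total sDes (wt γ) = χ(γ)
total : ∀ {n N} → (Fin N → SignedSet n) → (SignedSet n → ℤ) → ℤ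
total {N = N} sDes φ = sumℤ (map (λ b → φ (sDes b)) (allFin N))

module _ {n N : ℕ} (sDes : Fin N → SignedSet n) where

  total-cong : ∀ {φ ψ} → (∀ τ → φ τ ≡ ψ τ) → total sDes φ ≡ total sDes ψ
  total-cong φ≗ψ = cong sumℤ (map-cong (λ b → φ≗ψ (sDes b)) (allFin N))

  total-scale : ∀ c φ → total sDes (λ τ → c * φ τ) ≡ c * total sDes φ
  total-scale c φ = sumℤ-scale c (λ b → φ (sDes b)) (allFin N)

  total-add : ∀ φ ψ → total sDes (λ τ → φ τ + ψ τ) ≡ total sDes φ + total sDes ψ
  total-add φ ψ = sumℤ-add (λ b → φ (sDes b)) (λ b → ψ (sDes b)) (allFin N)

totals-agree : ∀ {n N N′} (sDes : Fin N → SignedSet n) (sDes′ : Fin N′ → SignedSet n) →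
  (∀ γ → total sDes (wt γ) ≡ total sDes′ (wt γ)) →
  ∀ {φ} → Spanned n 0 φ → total sDes φ ≡ total sDes′ φ
totals-agree sDes sDes′ agree-on-weights {φ} (spanning k f e) =
  ℤP.*-cancelˡ-≡ (+ suc k) _ _ (begin
    + suc k * total sDes φ             ≡⟨ sym (total-scale sDes (+ suc k) φ) ⟩
    total sDes (λ τ → + suc k * φ τ)   ≡⟨ total-cong sDes e ⟩
    total sDes (evaluate 0 f)          ≡⟨ agree-on-combination f ⟩
    total sDes′ (evaluate 0 f)         ≡⟨ sym (total-cong sDes′ e) ⟩
    total sDes′ (λ τ → + suc k * φ τ)  ≡⟨ total-scale sDes′ (+ suc k) φ ⟩
    + suc k * total sDes′ φ            ∎)
  where
  agree-on-combination : ∀ f → total sDes (evaluate 0 f) ≡ total sDes′ (evaluate 0 f)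
  agree-on-combination (weight γ) = begin
    total sDes (boostedWt 0 γ)   ≡⟨ total-cong sDes (boostedWt-zero γ) ⟩
    total sDes (wt γ)            ≡⟨ agree-on-weights γ ⟩
    total sDes′ (wt γ)           ≡⟨ sym (total-cong sDes′ (boostedWt-zero γ)) ⟩
    total sDes′ (boostedWt 0 γ)  ∎
  agree-on-combination (scale c f) = begin
    total sDes (λ τ → c * evaluate 0 f τ)   ≡⟨ total-scale sDes c (evaluate 0 f) ⟩
    c * total sDes (evaluate 0 f)           ≡⟨ cong (c *_) (agree-on-combination f) ⟩
    c * total sDes′ (evaluate 0 f)          ≡⟨ sym (total-scale sDes′ c (evaluate 0 f)) ⟩
    total sDes′ (λ τ → c * evaluate 0 f τ)  ∎
  agree-on-combination (f ⊕ g) = begin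
    total sDes (λ τ → evaluate 0 f τ + evaluate 0 g τ)
      ≡⟨ total-add sDes (evaluate 0 f) (evaluate 0 g) ⟩
    total sDes (evaluate 0 f) + total sDes (evaluate 0 g)
      ≡⟨ cong₂ _+_ (agree-on-combination f) (agree-on-combination g) ⟩
    total sDes′ (evaluate 0 f) + total sDes′ (evaluate 0 g)
      ≡⟨ sym (total-add sDes′ (evaluate 0 f) (evaluate 0 g)) ⟩
    total sDes′ (λ τ → evaluate 0 f τ + evaluate 0 g τ) ∎

indicator : ∀ {n} → SignedSet n → SignedSet n → ℤ
indicator σ τ with τ ≟SS σ
... | yes _ = 1ℤ
... | no  _ = 0ℤ

total-indicator : ∀ {n N} (sDes : Fin N → SignedSet n) σ → total sDes (indicator σ) ≡ + fiberSize sDes σ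
total-indicator {N = N} sDes σ = count (allFin N)
  where
  count : ∀ L →
    sumℤ (map (λ b → indicator σ (sDes b)) L) ≡ + length (filter (λ b → sDes b ≟SS σ) L)
  count []      = refl
  count (b ∷ L) with sDes b ≟SS σ
  ... | yes _ = cong (λ r → 1ℤ + r) (count L)
  ... | no  _ = trans (ℤP.+-identityˡ _) (count L)

theorem4p4 : (n : ℕ) (χ : ClassFunction) (N N′ : ℕ)
             (sDes : Fin N → SignedSet n) (sDes′ : Fin N′ → SignedSet n) →
             IsFineSet χ sDes → IsFineSet χ sDes′ →
             (σ : SignedSet n) → fiberSize sDes σ ≡ fiberSize sDes′ σ
theorem4p4 zero    χ N N′ sDes sDes′ fine fine′ ()
theorem4p4 (suc m) χ N N′ sDes sDes′ fine fine′ σ = ℤP.+-injective (begin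
  + fiberSize sDes σ         ≡⟨ sym (total-indicator sDes σ) ⟩
  total sDes (indicator σ)   ≡⟨ totals-agree sDes sDes′ (λ γ → trans (sym (fine γ)) (fine′ γ))
                                                (allSpanned m 0 (indicator σ)) ⟩
  total sDes′ (indicator σ)  ≡⟨ total-indicator sDes′ σ ⟩
  + fiberSize sDes′ σ        ∎)
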